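{- Let $m$ be a positive integer and let $p_{1,2},p_{1,3},p_{1,4},p_{2,3},p_{2,4},p_{3,4}$ be pairwise distinct primes. Then every positive integer \[ n\ge p_{1,2}^m p_{1,4}^m p_{2,4}^m + p_{1,2}^m p_{1,3}^m p_{2,3}^m + p_{1,3}^m p_{1,4}^m p_{2,3}^m p_{2,4}^m p_{3,4}^m + 2 p_{1,2}^m p_{1,4}^m p_{2,3}^m p_{2,4}^m p_{3,4}^m + 2 p_{1,2}^m p_{1,3}^m p_{1,4}^m p_{2,4}^m p_{3,4}^m \] can be written as $n=\mu_1+\mu_2+\mu_3+\mu_4$ with positive integers $\mu_1,\ldots,\mu_4$ such that $(\mu_1,\mu_2,\mu_3,\mu_4)_m=1$ and $(\mu_i,\mu_j)_m>1$ for all $i,j\in\{1,2,3,4\}$.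
   Context: $(b_1,\ldots,b_k)_m$ denotes the largest integer of the form $d^m$, $d\in\mathbb{N}$, dividing all of $b_1,\ldots,b_k$. -}

module Defs where

open import Data.Nat using (ℕ; _^_; _≤_; _+_; _*_)
open import Data.Nat.Divisibility using (_∣_)
open import Data.Product using (Σ; _×_)
open import Data.Vec using (Vec)
open import Data.Vec.Relation.Unary.All using (All)
open import Relation.Binary.PropositionalEquality using (_≡_)

-- g is the largest integer of the form d^m (d ∈ ℕ) dividing every entry of bs,
-- i.e. g = (b_1,…,b_k)_m in the paper's notation.
IsPowGcd : ℕ → {k : ℕ} → Vec ℕ k → ℕ → Set
IsPowGcd m bs g =
  (Σ ℕ λ d → g ≡ d ^ m)
  × All (λ b → g ∣ b) bs
  × (∀ e → All (λ b → e ^ m ∣ b) bs → e ^ m ≤ g)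

bound : ℕ → ℕ → ℕ → ℕ → ℕ → ℕ → ℕ → ℕ
bound m p12 p13 p14 p23 p24 p34 =
    p12 ^ m * p14 ^ m * p24 ^ m
  + p12 ^ m * p13 ^ m * p23 ^ m
  + p13 ^ m * p14 ^ m * p23 ^ m * p24 ^ m * p34 ^ m
  + 2 * (p12 ^ m * p14 ^ m * p23 ^ m * p24 ^ m * p34 ^ m)
  + 2 * (p12 ^ m * p13 ^ m * p14 ^ m * p24 ^ m * p34 ^ m)

{-# OPTIONS --safe #-}
module Submission where

-- Attach the prime p_ij to the edge ij of the complete graph on {1,2,3,4} and put
-- μ_i = x_i · ∏_{j ≠ i} p_ij^m with x_3 = 1.  Then p_ij^m divides μ_i and μ_j, while a prime
-- dividing all four μ_i would divide μ_3 = (p_13 p_23 p_34)^m; this is ruled out by asking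
-- p_23 ∤ x_1 and p_13, p_34 ∤ x_2.  Writing n − μ_3 = (p_12 p_23 p_24)^m x_2 + p_14^m R is a
-- linear congruence for x_2 modulo p_14^m, whose solution can be shifted by multiples of
-- p_14^m to avoid p_34 and p_13; then R = (p_12 p_13)^m x_1 + (p_24 p_34)^m x_4 is solved in
-- the same way, avoiding p_23.  The bound on n leaves enough room for both steps.

open import Data.Nat
open import Data.Nat.Properties
open import Data.Nat.Divisibility
open import Data.Nat.DivMod using (_%_; _/_; m≡m%n+[m/n]*n; m%n<n)
open import Data.Nat.GCD using (module Bézout)
open import Data.Nat.Coprimality using (Coprime; coprime-Bézout)
open import Data.Nat.Primality
open import Data.Nat.Primality.Factorisation using (factorise)
open import Data.Nat.ListAction using (product)
open import Data.Nat.Tactic.RingSolver using (solve-∀)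
open import Data.Fin using (Fin)
open import Data.Fin.Patterns
open import Data.Fin.Properties using (all?; any?) renaming (_≟_ to _≟ᶠ_)
open import Data.List using (List; []; _∷_)
open import Data.List.Membership.Propositional using (_∈_; _∉_; find)
open import Data.List.Membership.DecPropositional (_≟ᶠ_ {6}) using (_∈?_; _∉?_)
open import Data.List.Relation.Unary.Any as Any using (Any; here; there)
import Data.List.Relation.Unary.All as List
open import Data.Vec using (Vec; []; _∷_; lookup)
open import Data.Vec.Relation.Unary.All as All using (All; []; _∷_)
open import Data.Vec.Relation.Unary.All.Properties using (lookup⁺)
open import Data.Sum using (inj₁; inj₂; [_,_]′)
open import Data.Product using (Σ; ∃; ∃₂; _×_; _,_)
open import Function using (_∘_)
open import Relation.Nullary using (¬_; yes; no; contradiction)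
open import Relation.Nullary.Decidable using (from-yes; from-no; _×-dec_)
open import Relation.Unary using (Decidable)
open import Relation.Binary.PropositionalEquality
open import Defs

infix 4 _≡_mod_

_≡_mod_ : ℕ → ℕ → ℕ → Set
u ≡ v mod a = ∃₂ λ X Y → u + X * a ≡ v + Y * a

≡mod-sym : ∀ {u v a} → u ≡ v mod a → v ≡ u mod a
≡mod-sym (X , Y , eq) = Y , X , sym eq

≡mod-trans : ∀ {u v w a} → u ≡ v mod a → v ≡ w mod a → u ≡ w mod a
≡mod-trans {u} {v} {w} {a} (X , Y , eq₁) (X′ , Y′ , eq₂) = X + X′ , Y′ + Y , (begin
  u + (X + X′) * a    ≡⟨ shuffle u X X′ a ⟩
  u + X * a + X′ * a  ≡⟨ cong (_+ X′ * a) eq₁ ⟩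
  v + Y * a + X′ * a  ≡⟨ shuffle′ v Y X′ a ⟩
  v + X′ * a + Y * a  ≡⟨ cong (_+ Y * a) eq₂ ⟩
  w + Y′ * a + Y * a  ≡⟨ shuffle w Y′ Y a ⟨
  w + (Y′ + Y) * a    ∎)
  where
  open ≡-Reasoning
  shuffle : ∀ u X X′ a → u + (X + X′) * a ≡ u + X * a + X′ * a
  shuffle = solve-∀
  shuffle′ : ∀ v Y X′ a → v + Y * a + X′ * a ≡ v + X′ * a + Y * a
  shuffle′ = solve-∀

≡mod-*ˡ : ∀ {u v a} c → u ≡ v mod a → c * u ≡ c * v mod a
≡mod-*ˡ {u} {v} {a} c (X , Y , eq) = c * X , c * Y , (begin
  c * u + c * X * a    ≡⟨ distrib c u X a ⟩
  c * (u + X * a)      ≡⟨ cong (c *_) eq ⟩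
  c * (v + Y * a)      ≡⟨ distrib c v Y a ⟨
  c * v + c * Y * a    ∎)
  where
  open ≡-Reasoning
  distrib : ∀ c u X a → c * u + c * X * a ≡ c * (u + X * a)
  distrib = solve-∀

≡mod-representative : ∀ {a} .{{_ : NonZero a}} T → ∃ λ t → 1 ≤ t × t ≤ a × T ≡ t mod a
≡mod-representative {a} T with T % a | m≡m%n+[m/n]*n T a | m%n<n T a
... | suc r | T≡r+q*a | r<a = suc r , s≤s z≤n , <⇒≤ r<a , 0 , T / a , trans (+-identityʳ T) T≡r+q*a
... | zero  | T≡q*a   | _   = a , >-nonZero⁻¹ a , ≤-refl , 1 , T / a , (begin
  T + 1 * a          ≡⟨ cong (_+ 1 * a) T≡q*a ⟩
  T / a * a + 1 * a  ≡⟨ +-comm (T / a * a) (1 * a) ⟩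
  1 * a + T / a * a  ≡⟨ cong (_+ T / a * a) (*-identityˡ a) ⟩
  a + T / a * a      ∎)
  where open ≡-Reasoning

≡mod-cancel : ∀ {u v a} .{{_ : NonZero a}} → u ≡ v mod a → u ≤ v → ∃ λ K → v ≡ u + K * a
≡mod-cancel {u} {v} {a} (X , Y , eq) u≤v = X ∸ Y , +-cancelʳ-≡ (Y * a) v (u + (X ∸ Y) * a) (begin
  v + Y * a            ≡⟨ eq ⟨
  u + X * a            ≡⟨ cong (λ z → u + z * a) (m∸n+n≡m Y≤X) ⟨
  u + (X ∸ Y + Y) * a  ≡⟨ cong (u +_) (*-distribʳ-+ a (X ∸ Y) Y) ⟩
  u + ((X ∸ Y) * a + Y * a) ≡⟨ +-assoc u _ _ ⟨
  u + (X ∸ Y) * a + Y * a ∎)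
  where
  open ≡-Reasoning
  Y≤X : Y ≤ X
  Y≤X = *-cancelʳ-≤ Y X a (+-cancelˡ-≤ u (Y * a) (X * a)
    (≤-trans (+-monoˡ-≤ (Y * a) u≤v) (≤-reflexive (sym eq))))

coprime⇒solvable : ∀ {a b} .{{_ : NonZero a}} → Coprime a b → ∀ M → ∃ λ T → b * T ≡ M mod a
coprime⇒solvable {a} {b} cop M with coprime-Bézout cop
... | Bézout.-+ x y 1+xa≡yb = y * M , 0 , x * M , (begin
  b * (y * M) + 0 * a  ≡⟨ lhs b y M a ⟩
  y * b * M            ≡⟨ cong (_* M) 1+xa≡yb ⟨
  (1 + x * a) * M      ≡⟨ rhs x a M ⟩
  M + x * M * a        ∎)
  where
  open ≡-Reasoning
  lhs : ∀ b y M a → b * (y * M) + 0 * a ≡ y * b * M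
  lhs = solve-∀
  rhs : ∀ x a M → (1 + x * a) * M ≡ M + x * M * a
  rhs = solve-∀
-- Here b y ≡ −1 modulo a, so the factor a − 1 ≡ −1 restores the sign.
coprime⇒solvable {suc a′} {b} cop M | Bézout.+- x y 1+yb≡xa =
  y * M * a′ , M , x * M * a′ , (begin
  b * (y * M * a′) + M * suc a′  ≡⟨ lhs b y M a′ ⟩
  M + M * a′ * (1 + y * b)       ≡⟨ cong (λ z → M + M * a′ * z) 1+yb≡xa ⟩
  M + M * a′ * (x * suc a′)      ≡⟨ rhs M a′ x ⟩
  M + x * M * a′ * suc a′        ∎)
  where
  open ≡-Reasoning
  lhs : ∀ b y M a′ → b * (y * M * a′) + M * suc a′ ≡ M + M * a′ * (1 + y * b)
  lhs = solve-∀
  rhs : ∀ M a′ x → M + M * a′ * (x * suc a′) ≡ M + x * M * a′ * suc a′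
  rhs = solve-∀

coprime⇒representable : ∀ {a b M} .{{_ : NonZero a}} → Coprime a b → b * a ≤ M →
                        ∃₂ λ t K → 1 ≤ t × M ≡ b * t + K * a
coprime⇒representable {a} {b} {M} cop ba≤M =
  let T , bT≡M         = coprime⇒solvable cop M
      t , 1≤t , t≤a , T≡t = ≡mod-representative T
      K , M≡bt+Ka      = ≡mod-cancel (≡mod-trans (≡mod-sym (≡mod-*ˡ b T≡t)) bT≡M)
                                     (≤-trans (*-monoʳ-≤ b t≤a) ba≤M)
  in t , K , 1≤t , M≡bt+Ka

avoid-prime : ∀ {p d} → ¬ p ∣ d → ∀ x → ∃ λ k → k ≤ 1 × ¬ p ∣ x + k * d
avoid-prime {p} {d} p∤d x with p ∣? x
... | no  p∤x = 0 , z≤n , p∤x ∘ subst (p ∣_) (+-identityʳ x)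
... | yes p∣x = 1 , ≤-refl , λ p∣x+d → p∤d (∣m+n∣m⇒∣n (subst (λ z → p ∣ x + z) (*-identityˡ d) p∣x+d) p∣x)

avoid-two-primes : ∀ {p q c d} → ¬ p ∣ d → p ∣ c → ¬ q ∣ c * d → ∀ x →
                   ∃ λ k → k ≤ 1 + c × ¬ p ∣ x + k * d × ¬ q ∣ x + k * d
avoid-two-primes {p} {q} {c} {d} p∤d p∣c q∤cd x =
  let k₁ , k₁≤1 , p∤x′ = avoid-prime p∤d x
      k₂ , k₂≤1 , q∤x″ = avoid-prime q∤cd (x + k₁ * d)
      split = regroup x k₁ k₂ c d
  in k₁ + k₂ * c
   , +-mono-≤ k₁≤1 (≤-trans (*-monoˡ-≤ c k₂≤1) (≤-reflexive (*-identityˡ c)))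
   , (λ p∣x+kd → p∤x′ (∣m+n∣m⇒∣n (subst (p ∣_) split p∣x+kd) (∣-trans p∣c (∣-trans (m∣m*n d) (n∣m*n k₂)))))
   , q∤x″ ∘ subst (q ∣_) (trans split (+-comm (k₂ * (c * d)) (x + k₁ * d)))
  where
  regroup : ∀ x k₁ k₂ c d → x + (k₁ + k₂ * c) * d ≡ k₂ * (c * d) + (x + k₁ * d)
  regroup = solve-∀

coprime⇒good-representation : ∀ {a b} .{{_ : NonZero a}} → Coprime a b →
  (Good : ℕ → Set) (s : ℕ) → (∀ t → ∃ λ k → k ≤ s × Good (t + k * a)) →
  ∀ {y₀ N} → b * a * (1 + s) + y₀ * a ≤ N →
  ∃₂ λ x y → 1 ≤ x × Good x × y₀ ≤ y × N ≡ b * x + y * a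
coprime⇒good-representation {a} {b} cop Good s shift {y₀} {N} bound =
  finish (coprime⇒representable cop (m+n≤o⇒m≤o∸n (b * a) ba+L≤N))
  where
  open ≡-Reasoning
  L = b * a * s + y₀ * a
  peel : ∀ b a s y₀ → b * a * (1 + s) + y₀ * a ≡ b * a + (b * a * s + y₀ * a)
  peel = solve-∀
  ba+L≤N : b * a + L ≤ N
  ba+L≤N = subst (_≤ N) (peel b a s y₀) bound
  collect : ∀ b a k j y₀ t K → b * a * (k + j) + y₀ * a + (b * t + K * a) ≡ b * (t + k * a) + (b * j + y₀ + K) * a
  collect = solve-∀
  finish : (∃₂ λ t K → 1 ≤ t × N ∸ L ≡ b * t + K * a) → ∃₂ λ x y → 1 ≤ x × Good x × y₀ ≤ y × N ≡ b * x + y * a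
  finish (t , K , 1≤t , N∸L≡bt+Ka) with k , k≤s , good ← shift t =
    t + k * a , b * (s ∸ k) + y₀ + K , ≤-trans 1≤t (m≤m+n t (k * a)) , good ,
    ≤-trans (m≤n+m y₀ (b * (s ∸ k))) (m≤m+n _ K) , (begin
    N                                             ≡⟨ m+[n∸m]≡n (m+n≤o⇒n≤o (b * a) ba+L≤N) ⟨
    L + (N ∸ L)                                   ≡⟨ cong (L +_) N∸L≡bt+Ka ⟩
    b * a * s + y₀ * a + (b * t + K * a)          ≡⟨ cong (λ z → b * a * z + y₀ * a + (b * t + K * a)) (m+[n∸m]≡n k≤s) ⟨
    b * a * (k + (s ∸ k)) + y₀ * a + (b * t + K * a) ≡⟨ collect b a k (s ∸ k) y₀ t K ⟩
    b * (t + k * a) + (b * (s ∸ k) + y₀ + K) * a  ∎)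

n≤n^m : ∀ n {m} → 1 ≤ m → n ≤ n ^ m
n≤n^m zero               _ = z≤n
n≤n^m n@(suc _) {suc m} _ = m≤m*n n (n ^ m) {{m^n≢0 n m}}

n∣n^m : ∀ n {m} → 1 ≤ m → n ∣ n ^ m
n∣n^m n {suc m} _ = m∣m*n (n ^ m)

m+n≤m*n : ∀ {m n} → 2 ≤ m → 2 ≤ n → m + n ≤ m * n
m+n≤m*n {m@(suc (suc m′))} {n@(suc (suc n′))} (s≤s (s≤s _)) (s≤s (s≤s _)) =
  subst (m + n ≤_) (sym (expand m′ n′)) (m≤m+n (m + n) _)
  where
  expand : ∀ m′ n′ → (2 + m′) * (2 + n′) ≡ 2 + m′ + (2 + n′) + (m′ + n′ + m′ * n′)
  expand = solve-∀

no-prime-divisor⇒≡1 : ∀ {n} .{{_ : NonZero n}} → (∀ {q} → Prime q → ¬ q ∣ n) → n ≡ 1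
no-prime-divisor⇒≡1 {1} _ = refl
no-prime-divisor⇒≡1 {n@(suc (suc _))} no-prime with factorise n
... | record { factors = [] ; isFactorisation = () }
... | record { factors = q ∷ qs ; isFactorisation = n≡q*Πqs ; factorsPrime = q-prime List.∷ _ } =
  contradiction (divides (product qs) (trans n≡q*Πqs (*-comm q (product qs)))) (no-prime q-prime)

∣⇒nonZero : ∀ {d n} .{{_ : NonZero n}} → d ∣ n → NonZero d
∣⇒nonZero {n = n} d∣n = ≢-nonZero λ { refl → ≢-nonZero⁻¹ n (0∣⇒≡0 d∣n) }

coprime-by-primes : ∀ {a b} .{{_ : NonZero a}} → (∀ {q} → Prime q → q ∣ a → ¬ q ∣ b) → Coprime a b
coprime-by-primes no-common (i∣a , i∣b) = no-prime-divisor⇒≡1 {{∣⇒nonZero i∣a}} λ q-prime q∣i →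
  no-common q-prime (∣-trans q∣i i∣a) (∣-trans q∣i i∣b)

prime∤1 : ∀ {q} → Prime q → ¬ q ∣ 1
prime∤1 q-prime q∣1 with refl ← ∣1⇒≡1 q∣1 = contradiction q-prime λ ()

prime∣prime⇒≡ : ∀ {p q} → Prime p → Prime q → q ∣ p → q ≡ p
prime∣prime⇒≡ p-prime q-prime q∣p with prime⇒irreducible p-prime q∣p
... | inj₁ refl = contradiction q-prime (λ ())
... | inj₂ q≡p  = q≡p

prime∣p^n⇒≡ : ∀ {p q} n → Prime p → Prime q → q ∣ p ^ n → q ≡ p
prime∣p^n⇒≡ zero    p-prime q-prime q∣1 = contradiction q∣1 (prime∤1 q-prime)
prime∣p^n⇒≡ {p} (suc n) p-prime q-prime q∣p^[1+n] with euclidsLemma p (p ^ n) q-prime q∣p^[1+n]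
... | inj₁ q∣p   = prime∣prime⇒≡ p-prime q-prime q∣p
... | inj₂ q∣p^n = prime∣p^n⇒≡ n p-prime q-prime q∣p^n

module PrimePowerProducts (m : ℕ) {k : ℕ} (p : Fin k → ℕ) (prime : ∀ i → Prime (p i))
                          (injective : ∀ i j → i ≢ j → p i ≢ p j) where

  Π : List (Fin k) → ℕ
  Π []           = 1
  Π (i ∷ [])     = p i ^ m
  Π (i ∷ j ∷ is) = p i ^ m * Π (j ∷ is)

  p^m∣Π : ∀ {i is} → i ∈ is → p i ^ m ∣ Π is
  p^m∣Π {is = _ ∷ []}     (here refl)  = ∣-refl
  p^m∣Π {is = _ ∷ j ∷ js} (here refl)  = m∣m*n (Π (j ∷ js))
  p^m∣Π {is = i ∷ j ∷ js} (there i∈js) = ∣-trans (p^m∣Π i∈js) (n∣m*n (p i ^ m))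

  Π-positive : ∀ is → 1 ≤ Π is
  Π-positive []           = ≤-refl
  Π-positive (i ∷ [])     = m^n>0 (p i) {{prime⇒nonZero (prime i)}} m
  Π-positive (i ∷ j ∷ is) = *-mono-≤ (Π-positive (i ∷ [])) (Π-positive (j ∷ is))

  prime∣Π⇒∈ : ∀ {q is} → Prime q → q ∣ Π is → Any (λ i → q ≡ p i) is
  prime∣Π⇒∈ {is = []}         q-prime q∣1 = contradiction q∣1 (prime∤1 q-prime)
  prime∣Π⇒∈ {is = i ∷ []}     q-prime q∣p^m = here (prime∣p^n⇒≡ m (prime i) q-prime q∣p^m)
  prime∣Π⇒∈ {is = i ∷ j ∷ is} q-prime q∣Π =
    [ here ∘ prime∣p^n⇒≡ m (prime i) q-prime , there ∘ prime∣Π⇒∈ q-prime ]′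
    (euclidsLemma (p i ^ m) (Π (j ∷ is)) q-prime q∣Π)

  p-injective : ∀ {i j} → p i ≡ p j → i ≡ j
  p-injective {i} {j} pi≡pj with i ≟ᶠ j
  ... | yes i≡j = i≡j
  ... | no  i≢j = contradiction pi≡pj (injective i j i≢j)

  ∉⇒∤Π : ∀ {j is} → j ∉ is → ¬ p j ∣ Π is
  ∉⇒∤Π j∉is = j∉is ∘ Any.map p-injective ∘ prime∣Π⇒∈ (prime _)

  ∉⇒∤Π* : ∀ {j is x} → j ∉ is → ¬ p j ∣ x → ¬ p j ∣ Π is * x
  ∉⇒∤Π* {j} {is} {x} j∉is pj∤x pj∣Π*x with euclidsLemma (Π is) x (prime j) pj∣Π*x
  ... | inj₁ pj∣Π = ∉⇒∤Π j∉is pj∣Π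
  ... | inj₂ pj∣x = pj∤x pj∣x

  disjoint⇒coprime : ∀ {is js} → List.All (_∉ js) is → Coprime (Π is) (Π js)
  disjoint⇒coprime {is} {js} disjoint = coprime-by-primes {{>-nonZero (Π-positive is)}} no-common
    where
    no-common : ∀ {q} → Prime q → q ∣ Π is → ¬ q ∣ Π js
    no-common q-prime q∣Πis with i , i∈is , refl ← find (prime∣Π⇒∈ q-prime q∣Πis) = ∉⇒∤Π (List.lookup disjoint i∈is)

greatest-below : ∀ {P : ℕ → Set} → Decidable P → ∀ {d₀} → P d₀ → ∀ B →
                 ∃ λ d → P d × ∀ e → e ≤ B → P e → e ≤ d
greatest-below P? {d₀} Pd₀ zero = d₀ , Pd₀ , λ { zero _ _ → z≤n }
greatest-below P? Pd₀ (suc B) with P? (suc B)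
... | yes PB = suc B , PB , λ e e≤B _ → e≤B
... | no ¬PB with d , Pd , below ← greatest-below P? Pd₀ B = d , Pd , λ e e≤1+B Pe → below e (s≤s⁻¹ (≤∧≢⇒< e≤1+B λ { refl → ¬PB Pe })) Pe

powGcd-exists : ∀ {m} → 1 ≤ m → ∀ {k} b (bs : Vec ℕ k) → .{{_ : NonZero b}} → ∃ (IsPowGcd m (b ∷ bs))
powGcd-exists {m} 1≤m b bs =
  let d , Pd , below = greatest-below (λ d → All.all? (λ x → d ^ m ∣? x) (b ∷ bs)) one-divides b
  in d ^ m , (d , refl) , Pd ,
     λ e e^m∣bs → ^-monoˡ-≤ m (below e (≤-trans (n≤n^m e 1≤m) (∣⇒≤ (All.head e^m∣bs))) e^m∣bs)
  where
  one-divides : All (λ x → 1 ^ m ∣ x) (b ∷ bs)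
  one-divides = All.universal (λ x → subst (_∣ x) (sym (^-zeroˡ m)) (1∣ x)) (b ∷ bs)

module Construction (m : ℕ) (1≤m : 1 ≤ m) (p : Fin 6 → ℕ) (prime : ∀ i → Prime (p i))
                    (injective : ∀ i j → i ≢ j → p i ≢ p j) where

  open PrimePowerProducts m p prime injective

  -- p 0F, …, p 5F are p₁₂, p₁₃, p₁₄, p₂₃, p₂₄, p₃₄, and edges i lists the primes at vertex i + 1.
  edges : Fin 4 → List (Fin 6)
  edges 0F = 0F ∷ 1F ∷ 2F ∷ []
  edges 1F = 0F ∷ 3F ∷ 4F ∷ []
  edges 2F = 1F ∷ 3F ∷ 5F ∷ []
  edges 3F = 2F ∷ 4F ∷ 5F ∷ []

  shared-edge : ∀ i j → ∃ λ e → e ∈ edges i × e ∈ edges j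
  shared-edge = from-yes (all? λ i → all? λ j → any? λ e → e ∈? edges i ×-dec e ∈? edges j)

  2≤p^m : ∀ i → 2 ≤ p i ^ m
  2≤p^m i = ≤-trans (nonTrivial⇒n>1 (p i) {{prime⇒nonTrivial (prime i)}}) (n≤n^m (p i) 1≤m)

  a₁₄ a₃₄ α β : ℕ
  a₁₄ = p 2F ^ m
  a₃₄ = p 5F ^ m
  α   = Π (0F ∷ 1F ∷ [])
  β   = Π (4F ∷ 5F ∷ [])

  threshold-αβ threshold-x₂ threshold : ℕ
  threshold-αβ = α * β * (1 + 1) + 1 * β
  threshold-x₂ = Π (edges 1F) * a₁₄ * (1 + (1 + a₃₄)) + threshold-αβ * a₁₄
  threshold    = threshold-x₂ + Π (edges 2F)

  summand : (x₁ x₂ x₄ : ℕ) → Fin 4 → ℕ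
  summand x₁ x₂ x₄ 0F = Π (edges 0F) * x₁
  summand x₁ x₂ x₄ 1F = Π (edges 1F) * x₂
  summand x₁ x₂ x₄ 2F = Π (edges 2F)
  summand x₁ x₂ x₄ 3F = Π (edges 3F) * x₄

  record Decomposition (n : ℕ) : Set where
    field
      x₁ x₂ x₄ : ℕ
      x₁-positive : 1 ≤ x₁
      x₂-positive : 1 ≤ x₂
      x₄-positive : 1 ≤ x₄
      p₂₃∤x₁ : ¬ p 3F ∣ x₁
      p₁₃∤x₂ : ¬ p 1F ∣ x₂
      p₃₄∤x₂ : ¬ p 5F ∣ x₂
      sum : n ≡ summand x₁ x₂ x₄ 0F + summand x₁ x₂ x₄ 1F + summand x₁ x₂ x₄ 2F + summand x₁ x₂ x₄ 3F

  regroup : ∀ x₁ x₂ x₄ → Π (edges 1F) * x₂ + (α * x₁ + x₄ * β) * a₁₄ + Π (edges 2F)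
                        ≡ summand x₁ x₂ x₄ 0F + summand x₁ x₂ x₄ 1F + summand x₁ x₂ x₄ 2F + summand x₁ x₂ x₄ 3F
  regroup = expand (p 0F ^ m) (p 1F ^ m) a₁₄ (p 3F ^ m) (p 4F ^ m) a₃₄
    where
    expand : ∀ a₁₂ a₁₃ a₁₄ a₂₃ a₂₄ a₃₄ x₁ x₂ x₄ →
      a₁₂ * (a₂₃ * a₂₄) * x₂ + (a₁₂ * a₁₃ * x₁ + x₄ * (a₂₄ * a₃₄)) * a₁₄ + a₁₃ * (a₂₃ * a₃₄)
      ≡ a₁₂ * (a₁₃ * a₁₄) * x₁ + a₁₂ * (a₂₃ * a₂₄) * x₂ + a₁₃ * (a₂₃ * a₃₄) + a₁₄ * (a₂₄ * a₃₄) * x₄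
    expand = solve-∀

  a₁₄-coprime-Π₁ : Coprime a₁₄ (Π (edges 1F))
  a₁₄-coprime-Π₁ = disjoint⇒coprime (from-yes (List.all? (_∉? edges 1F) (2F ∷ [])))

  β-coprime-α : Coprime β α
  β-coprime-α = disjoint⇒coprime (from-yes (List.all? (_∉? 0F ∷ 1F ∷ []) (4F ∷ 5F ∷ [])))

  avoid-p₃₄-p₁₃ : ∀ t → ∃ λ k → k ≤ 1 + a₃₄ × ¬ p 5F ∣ t + k * a₁₄ × ¬ p 1F ∣ t + k * a₁₄
  avoid-p₃₄-p₁₃ = avoid-two-primes (∉⇒∤Π (from-no (5F ∈? 2F ∷ []))) (n∣n^m (p 5F) 1≤m)
                                   (∉⇒∤Π* (from-no (1F ∈? 5F ∷ [])) (∉⇒∤Π (from-no (1F ∈? 2F ∷ []))))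

  avoid-p₂₃ : ∀ t → ∃ λ k → k ≤ 1 × ¬ p 3F ∣ t + k * β
  avoid-p₂₃ = avoid-prime (∉⇒∤Π (from-no (3F ∈? 4F ∷ 5F ∷ [])))

  decompose : ∀ {n} → threshold ≤ n → Decomposition n
  decompose {n} threshold≤n =
    let x₂ , R , x₂-positive , (p₃₄∤x₂ , p₁₃∤x₂) , threshold-αβ≤R , n∸μ₃≡Π₁*x₂+R*a₁₄ =
          coprime⇒good-representation {{>-nonZero (Π-positive (2F ∷ []))}} a₁₄-coprime-Π₁
            (λ x → ¬ p 5F ∣ x × ¬ p 1F ∣ x) (1 + a₃₄) avoid-p₃₄-p₁₃ (m+n≤o⇒m≤o∸n threshold-x₂ threshold≤n)
        x₁ , x₄ , x₁-positive , p₂₃∤x₁ , x₄-positive , R≡α*x₁+x₄*β =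
          coprime⇒good-representation {{>-nonZero (Π-positive (4F ∷ 5F ∷ []))}} β-coprime-α
            (λ x → ¬ p 3F ∣ x) 1 avoid-p₂₃ threshold-αβ≤R
        open ≡-Reasoning
    in record
      { x₁ = x₁ ; x₂ = x₂ ; x₄ = x₄
      ; x₁-positive = x₁-positive ; x₂-positive = x₂-positive ; x₄-positive = x₄-positive
      ; p₂₃∤x₁ = p₂₃∤x₁ ; p₁₃∤x₂ = p₁₃∤x₂ ; p₃₄∤x₂ = p₃₄∤x₂
      ; sum = begin
          n                                                        ≡⟨ m∸n+n≡m (m+n≤o⇒n≤o threshold-x₂ threshold≤n) ⟨
          n ∸ Π (edges 2F) + Π (edges 2F)                          ≡⟨ cong (_+ Π (edges 2F)) n∸μ₃≡Π₁*x₂+R*a₁₄ ⟩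
          Π (edges 1F) * x₂ + R * a₁₄ + Π (edges 2F)               ≡⟨ cong (λ r → Π (edges 1F) * x₂ + r * a₁₄ + Π (edges 2F)) R≡α*x₁+x₄*β ⟩
          Π (edges 1F) * x₂ + (α * x₁ + x₄ * β) * a₁₄ + Π (edges 2F) ≡⟨ regroup x₁ x₂ x₄ ⟩
          _                                                        ∎
      }

  threshold≤bound : threshold ≤ bound m (p 0F) (p 1F) (p 2F) (p 3F) (p 4F) (p 5F)
  threshold≤bound = begin
    threshold
      ≡⟨ reshape a₁₂ a₁₃ a₁₄ a₂₃ a₂₄ a₃₄ ⟩
    (a₁₃ * a₂₃ + a₁₄ * a₂₄) * a₃₄ + a₁₂ * a₂₃ * a₂₄ * a₁₄ * (2 + a₃₄) + 2 * (a₁₂ * a₁₃ * a₁₄ * a₂₄ * a₃₄)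
      ≤⟨ +-monoˡ-≤ _ (+-mono-≤ (*-monoˡ-≤ a₃₄ (m+n≤m*n (2≤product 1F 3F) (2≤product 2F 4F)))
                               (*-monoʳ-≤ (a₁₂ * a₂₃ * a₂₄ * a₁₄) (+-monoˡ-≤ a₃₄ (2≤p^m 5F)))) ⟩
    a₁₃ * a₂₃ * (a₁₄ * a₂₄) * a₃₄ + a₁₂ * a₂₃ * a₂₄ * a₁₄ * (a₃₄ + a₃₄) + 2 * (a₁₂ * a₁₃ * a₁₄ * a₂₄ * a₃₄)
      ≤⟨ m≤n+m _ (a₁₂ * a₁₄ * a₂₄ + a₁₂ * a₁₃ * a₂₃) ⟩
    a₁₂ * a₁₄ * a₂₄ + a₁₂ * a₁₃ * a₂₃
      + (a₁₃ * a₂₃ * (a₁₄ * a₂₄) * a₃₄ + a₁₂ * a₂₃ * a₂₄ * a₁₄ * (a₃₄ + a₃₄) + 2 * (a₁₂ * a₁₃ * a₁₄ * a₂₄ * a₃₄))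
      ≡⟨ reassociate a₁₂ a₁₃ a₁₄ a₂₃ a₂₄ a₃₄ ⟩
    bound m (p 0F) (p 1F) (p 2F) (p 3F) (p 4F) (p 5F) ∎
    where
    open ≤-Reasoning
    a₁₂ = p 0F ^ m
    a₁₃ = p 1F ^ m
    a₂₃ = p 3F ^ m
    a₂₄ = p 4F ^ m
    2≤product : ∀ i j → 2 ≤ p i ^ m * p j ^ m
    2≤product i j = *-mono-≤ (2≤p^m i) (Π-positive (j ∷ []))
    reshape : ∀ a₁₂ a₁₃ a₁₄ a₂₃ a₂₄ a₃₄ →
      a₁₂ * (a₂₃ * a₂₄) * a₁₄ * (1 + (1 + a₃₄)) + (a₁₂ * a₁₃ * (a₂₄ * a₃₄) * (1 + 1) + 1 * (a₂₄ * a₃₄)) * a₁₄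
        + a₁₃ * (a₂₃ * a₃₄)
      ≡ (a₁₃ * a₂₃ + a₁₄ * a₂₄) * a₃₄ + a₁₂ * a₂₃ * a₂₄ * a₁₄ * (2 + a₃₄) + 2 * (a₁₂ * a₁₃ * a₁₄ * a₂₄ * a₃₄)
    reshape = solve-∀
    reassociate : ∀ a₁₂ a₁₃ a₁₄ a₂₃ a₂₄ a₃₄ →
      a₁₂ * a₁₄ * a₂₄ + a₁₂ * a₁₃ * a₂₃
        + (a₁₃ * a₂₃ * (a₁₄ * a₂₄) * a₃₄ + a₁₂ * a₂₃ * a₂₄ * a₁₄ * (a₃₄ + a₃₄) + 2 * (a₁₂ * a₁₃ * a₁₄ * a₂₄ * a₃₄))
      ≡ a₁₂ * a₁₄ * a₂₄ + a₁₂ * a₁₃ * a₂₃ + a₁₃ * a₁₄ * a₂₃ * a₂₄ * a₃₄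
        + 2 * (a₁₂ * a₁₄ * a₂₃ * a₂₄ * a₃₄) + 2 * (a₁₂ * a₁₃ * a₁₄ * a₂₄ * a₃₄)
    reassociate = solve-∀

  module Properties {n} (D : Decomposition n) where
    open Decomposition D public

    μ : Fin 4 → ℕ
    μ = summand x₁ x₂ x₄

    μ-positive : ∀ i → 1 ≤ μ i
    μ-positive 0F = *-mono-≤ (Π-positive (edges 0F)) x₁-positive
    μ-positive 1F = *-mono-≤ (Π-positive (edges 1F)) x₂-positive
    μ-positive 2F = Π-positive (edges 2F)
    μ-positive 3F = *-mono-≤ (Π-positive (edges 3F)) x₄-positive

    Π∣μ : ∀ i → Π (edges i) ∣ μ i
    Π∣μ 0F = m∣m*n x₁
    Π∣μ 1F = m∣m*n x₂
    Π∣μ 2F = ∣-refl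
    Π∣μ 3F = m∣m*n x₄

    pairwise-powGcd>1 : ∀ i j → ∃ λ g → IsPowGcd m (μ i ∷ μ j ∷ []) g × 1 < g
    pairwise-powGcd>1 i j =
      let e , e∈i , e∈j = shared-edge i j
          g , isPowGcd = powGcd-exists 1≤m (μ i) (μ j ∷ []) {{>-nonZero (μ-positive i)}}
          _ , _ , greatest = isPowGcd
      in g , isPowGcd , ≤-trans (2≤p^m e) (greatest (p e) (p^m∣μ i e∈i ∷ p^m∣μ j e∈j ∷ []))
      where
      p^m∣μ : ∀ {e} i → e ∈ edges i → p e ^ m ∣ μ i
      p^m∣μ i e∈i = ∣-trans (p^m∣Π e∈i) (Π∣μ i)

    no-common-prime : ∀ {q} → Prime q → q ∣ μ 0F → q ∣ μ 1F → ¬ q ∣ μ 2F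
    no-common-prime q-prime q∣μ₀ q∣μ₁ q∣μ₂ with prime∣Π⇒∈ {is = edges 2F} q-prime q∣μ₂
    ... | here refl                 = ∉⇒∤Π* (from-no (1F ∈? edges 1F)) p₁₃∤x₂ q∣μ₁
    ... | there (here refl)         = ∉⇒∤Π* (from-no (3F ∈? edges 0F)) p₂₃∤x₁ q∣μ₀
    ... | there (there (here refl)) = ∉⇒∤Π* (from-no (5F ∈? edges 1F)) p₃₄∤x₂ q∣μ₁

    powGcd≡1 : IsPowGcd m (μ 0F ∷ μ 1F ∷ μ 2F ∷ μ 3F ∷ []) 1
    powGcd≡1 = (1 , sym (^-zeroˡ m)) , All.universal 1∣_ _ , λ { e (e^m∣μ₀ ∷ e^m∣μ₁ ∷ e^m∣μ₂ ∷ _) →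
      ≤-reflexive (no-prime-divisor⇒≡1 {{∣⇒nonZero {{>-nonZero (μ-positive 2F)}} e^m∣μ₂}} λ q-prime q∣e^m →
        no-common-prime q-prime (∣-trans q∣e^m e^m∣μ₀) (∣-trans q∣e^m e^m∣μ₁) (∣-trans q∣e^m e^m∣μ₂)) }


mainTheorem3 : (m : ℕ) → 1 ≤ m →
    (p12 p13 p14 p23 p24 p34 : ℕ) →
    All Prime (p12 ∷ p13 ∷ p14 ∷ p23 ∷ p24 ∷ p34 ∷ []) →
    (∀ (i j : Fin 6) → i ≢ j →
      lookup (p12 ∷ p13 ∷ p14 ∷ p23 ∷ p24 ∷ p34 ∷ []) i
        ≢ lookup (p12 ∷ p13 ∷ p14 ∷ p23 ∷ p24 ∷ p34 ∷ []) j) →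
    (n : ℕ) → 1 ≤ n → bound m p12 p13 p14 p23 p24 p34 ≤ n →
    Σ (Fin 4 → ℕ) λ μ →
      (∀ i → 1 ≤ μ i)
      × n ≡ μ Fin.zero + μ (Fin.suc Fin.zero) + μ (Fin.suc (Fin.suc Fin.zero))
              + μ (Fin.suc (Fin.suc (Fin.suc Fin.zero)))
      × (Σ ℕ λ g → IsPowGcd m (μ Fin.zero ∷ μ (Fin.suc Fin.zero)
                      ∷ μ (Fin.suc (Fin.suc Fin.zero))
                      ∷ μ (Fin.suc (Fin.suc (Fin.suc Fin.zero))) ∷ []) g × g ≡ 1)
      × (∀ (i j : Fin 4) → Σ ℕ λ g → IsPowGcd m (μ i ∷ μ j ∷ []) g × 1 < g)
mainTheorem3 m 1≤m p12 p13 p14 p23 p24 p34 primes distinct n _ bound≤n =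
  μ , μ-positive , sum , (1 , powGcd≡1 , refl) , pairwise-powGcd>1
  where
  open Construction m 1≤m (lookup (p12 ∷ p13 ∷ p14 ∷ p23 ∷ p24 ∷ p34 ∷ [])) (lookup⁺ primes) distinct
  open Properties (decompose (≤-trans threshold≤bound bound≤n))
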